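{- Let $(t_1,\dots,t_m)$ be a non-trivial cycle with $n$ runs and node divisors $p_1,q_1,\dots,p_n,q_n$. Then at least two of $p_1,q_1,\dots,p_n,q_n$ are not equal to $1$.
   Context: The subprime Fibonacci rule: from positive integers $x,y$ with $s=x+y$, the next term is $s$ if $s$ is prime and $s/p$ if $s$ is composite, $p$ the smallest prime factor of $s$. A non-trivial cycle of length $m$ is an $m$-tuple $(t_1,\dots,t_m)$ of positive integers, indices modulo $m$, with each $t_i$ obtained from $t_{i-2},t_{i-1}$ by this rule, the $t_i$ not all equal, and $m$ the minimal period. Its signature is $s_i=(t_{i-2}+t_{i-1})/t_i$. In such a cycle every even term is followed by two odd terms; if $t_e$ is even, the pair $(a,b)=(t_{e+1},t_{e+2})$ is a node, and the run of the node is $t_{e+1}$ up to the next even term. Let the $n$ even terms of one period (the number of runs) give nodes $(a_1,b_1),\dots,(a_n,b_n)$ in cyclic order, and let $p_i$ and $q_i$ be the signature values of $a_i$ and $b_i$ respectively (the divisors). Each $p_i,q_i$ is $1$ or an odd prime, and all other signature values equal $2$. -}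

module Defs where

open import Data.Nat using (ℕ; zero; suc; _+_; _*_; _≤_; _<_)
open import Data.Nat.DivMod using (_/_)
open import Data.Nat.Divisibility using (_∣_)
open import Data.Nat.Primality using (Prime)
open import Data.Product using (Σ; _×_; _,_; ∃)
open import Data.Sum using (_⊎_)
open import Relation.Nullary using (¬_)
open import Relation.Binary.PropositionalEquality using (_≡_; _≢_)

SmallestPrimeFactor : ℕ → ℕ → Set
SmallestPrimeFactor p s = Prime p × p ∣ s × (∀ q → Prime q → q ∣ s → p ≤ q)

SubprimeStep : ℕ → ℕ → ℕ → Set
SubprimeStep x y z =
  (Prime (x + y) × z ≡ x + y)
  ⊎ (¬ Prime (x + y) × ∃ λ p → SmallestPrimeFactor p (x + y) × x + y ≡ p * z)

-- natural division, total (returns 0 for divisor 0, which never occurs for cycles)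
_div_ : ℕ → ℕ → ℕ
a div zero    = 0
a div (suc b) = a / suc b

-- A sequence t indexed by ℕ with t (i + m) = t i represents the m-tuple
-- (t_1,…,t_m) with indices modulo m.
record NontrivialCycle (m : ℕ) (t : ℕ → ℕ) : Set where
  field
    period    : ∀ i → t (i + m) ≡ t i
    positive  : ∀ i → 0 < t i
    rule      : ∀ i → SubprimeStep (t i) (t (suc i)) (t (suc (suc i)))
    notConst  : ∃ λ i → ∃ λ j → t i ≢ t j
    m-pos     : 0 < m
    minimal   : ∀ d → 0 < d → d < m → ¬ (∀ i → t (i + d) ≡ t i)

signature : (ℕ → ℕ) → ℕ → ℕ
signature t k = (t k + t (suc k)) div t (suc (suc k))

-- Entries of the list p_1,q_1,…,p_n,q_n are indexed by pairs (e , b) with e < m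
-- and t (e + 2) even (one even term per period, giving node (t(e+3), t(e+4))),
-- b = 0 for p (divisor of a = t(e+3)) and b = 1 for q (divisor of b = t(e+4)).
-- nodeDivisor t e b = signature value of t (e + 3 + b).
nodeDivisor : (ℕ → ℕ) → ℕ → ℕ → ℕ
nodeDivisor t e b = signature t (suc e + b)

NodeEntry : ℕ → (ℕ → ℕ) → ℕ × ℕ → Set
NodeEntry m t (e , b) = e < m × 2 ∣ t (suc (suc e)) × b ≤ 1

module Submission where

-- Sort the steps of a cycle by their signature: an odd prime (the sum is then odd), 1 (the sum
-- is prime) or 2 (a halving).  The potential Ψ(k) = t_k + 2 t_{k+1} is unchanged by a halving,
-- which does not raise max(t_k, t_{k+1}) either, while a prime step raises Ψ by the new term, which
-- becomes that maximum.  Ψ returns to its value after a period, so a cycle without odd-prime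
-- divisions consists of halvings; the gaps |t_{k+1} - t_k| then halve at every step, hence vanish
-- by periodicity, and the cycle is constant.
-- Suppose t_0 + t_1 = (3 + r) t_2 is the only odd-prime division of a period; one of t_0, t_1 is
-- even.  If t_1 is, the next step cannot halve (t_2 would be even), so t_1 + t_2 is prime; going
-- once round from t_2, a further prime step would make Ψ grow too much, and halvings alone give
-- t_0 = 3 t_2, hence t_1 = r t_2.  If t_0 is, the step into t_1 cannot halve (evenness would
-- propagate back to t_0 and t_1), so t_1 is prime; going round from t_1, only halvings fit, and
-- they give t_0 = 2 t_2, hence t_1 = (1 + r) t_2.  So a prime is a multiple k t_2 with k ≥ 2,
-- forcing t_2 = 1 and t_0 + t_1 = 3 + r prime, except for r = 0, which contradicts positivity,
-- resp. the bound on the maximum.  Hence a period holds two odd-prime divisions; the quotient of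
-- each is the a-term of a node if the second summand is even and its b-term if the first one is,
-- so each divisor is one of the p_i, q_i.

open import Defs
open import Data.Nat
open import Data.Nat.Properties
open import Data.Nat.DivMod using (m≡m%n+[m/n]*n; m%n<n; %-distribˡ-+; m*n/n≡m)
open import Data.Nat.Divisibility
open import Data.Nat.Primality
open import Data.Nat.Tactic.RingSolver using (solve-∀)
open import Data.Product
open import Data.Sum
open import Data.Empty
open import Function using (id; _∘_)
open import Relation.Nullary
open import Relation.Binary.PropositionalEquality

odd⇒%2≡1 : ∀ n → ¬ 2 ∣ n → n % 2 ≡ 1
odd⇒%2≡1 n ¬2∣n with n % 2 | m%n<n n 2 | m%n≡0⇒n∣m n 2
... | 0           | _             | 2∣n = contradiction (2∣n refl) ¬2∣n
... | 1           | _             | _   = refl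
... | suc (suc _) | s≤s (s≤s ()) | _

odd+odd-even : ∀ {m n} → ¬ 2 ∣ m → ¬ 2 ∣ n → 2 ∣ m + n
odd+odd-even {m} {n} ¬2∣m ¬2∣n = m%n≡0⇒n∣m (m + n) 2 (begin
  (m + n) % 2           ≡⟨ %-distribˡ-+ m n 2 ⟩
  (m % 2 + n % 2) % 2   ≡⟨ cong₂ (λ a b → (a + b) % 2) (odd⇒%2≡1 m ¬2∣m) (odd⇒%2≡1 n ¬2∣n) ⟩
  0                     ∎)
  where open ≡-Reasoning

odd-sum⇒even-summand : ∀ {m n} → ¬ 2 ∣ m + n → 2 ∣ m ⊎ 2 ∣ n
odd-sum⇒even-summand {m} {n} odd with 2 ∣? m | 2 ∣? n
... | yes 2∣m | _       = inj₁ 2∣m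
... | no _    | yes 2∣n = inj₂ 2∣n
... | no ¬2∣m | no ¬2∣n = contradiction (odd+odd-even ¬2∣m ¬2∣n) odd

∣m+n∣n⇒∣m : ∀ {d m n} → d ∣ m + n → d ∣ n → d ∣ m
∣m+n∣n⇒∣m {d} {m} {n} d∣m+n = ∣m+n∣m⇒∣n (subst (d ∣_) (+-comm m n) d∣m+n)

prime[k*n]⇒n≡1 : ∀ k n → 2 ≤ k → Prime (k * n) → n ≡ 1
prime[k*n]⇒n≡1 1 n (s≤s ()) _
prime[k*n]⇒n≡1 k@(suc (suc _)) n _ pr with prime⇒irreducible pr (m∣m*n {k} n)
... | inj₁ ()
... | inj₂ k≡k*n = *-cancelˡ-≡ n 1 k (trans (sym k≡k*n) (sym (*-identityʳ k)))

cancel-multiple : ∀ {a b} c r z → a + b ≡ (c + r) * z → a ≡ c * z → b ≡ r * z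
cancel-multiple c r z a+b≡ refl = +-cancelˡ-≡ (c * z) _ _ (trans a+b≡ (*-distribʳ-+ z c r))

x≡2^[1+k]*x⇒x≡0 : ∀ x k → x ≡ 2 ^ suc k * x → x ≡ 0
x≡2^[1+k]*x⇒x≡0 zero    _ _ = refl
x≡2^[1+k]*x⇒x≡0 (suc x) k e = contradiction (sym 1≡2*2^k) (even≢odd (2 ^ k) 0)
  where
  1≡2*2^k : 1 ≡ 2 * 2 ^ k
  1≡2*2^k = *-cancelʳ-≡ 1 (2 ^ suc k) (suc x) (trans (*-identityˡ (suc x)) e)

periodic⇒≡% : ∀ {a} {A : Set a} m .{{_ : NonZero m}} (f : ℕ → A) →
              (∀ i → f (i + m) ≡ f i) → ∀ i → f i ≡ f (i % m)
periodic⇒≡% m f period i =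
  trans (cong f (m≡m%n+[m/n]*n i m)) (periods (i / m) (i % m))
  where
  periods : ∀ c j → f (j + c * m) ≡ f j
  periods zero    j = cong f (+-identityʳ j)
  periods (suc c) j = begin
    f (j + (m + c * m)) ≡⟨ cong f (trans (cong (j +_) (+-comm m (c * m))) (sym (+-assoc j (c * m) m))) ⟩
    f (j + c * m + m)   ≡⟨ period (j + c * m) ⟩
    f (j + c * m)       ≡⟨ periods c j ⟩
    f j                 ∎
    where open ≡-Reasoning

bounded-search : {P Q : ℕ → Set} → (∀ i → P i ⊎ Q i) →
                 ∀ L → (∃ λ i → i < L × P i) ⊎ (∀ i → i < L → Q i)
bounded-search P⊎Q zero = inj₂ (λ _ ())
bounded-search P⊎Q (suc L) with bounded-search P⊎Q L | P⊎Q L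
... | inj₁ (i , i<L , Pi) | _    = inj₁ (i , m<n⇒m<1+n i<L , Pi)
... | inj₂ _              | inj₁ PL = inj₁ (L , n<1+n L , PL)
... | inj₂ below          | inj₂ QL = inj₂ λ i i<1+L →
  [ below i , (λ { refl → QL }) ]′ (m≤n⇒m<n∨m≡n (s≤s⁻¹ i<1+L))

StepAt : (ℕ → ℕ → ℕ → Set) → (ℕ → ℕ) → ℕ → Set
StepAt R u i = R (u i) (u (suc i)) (u (suc (suc i)))

StepAt-+ : ∀ R u J i → StepAt R (λ k → u (J + k)) i ≡ StepAt R u (J + i)
StepAt-+ R u J i = cong₂ (R (u (J + i))) (cong u (+-suc J i))
  (cong u (trans (+-suc J (suc i)) (cong suc (+-suc J i))))

record OddPrimeDivision (x y z : ℕ) : Set where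
  field
    p             : ℕ
    3≤p           : 3 ≤ p
    p-prime       : Prime p
    sum-composite : ¬ Prime (x + y)
    sum≡p*z       : x + y ≡ p * z
    sum-odd       : ¬ 2 ∣ x + y

Halving : ℕ → ℕ → ℕ → Set
Halving x y z = x + y ≡ 2 * z

data PrimeOrHalving (x y z : ℕ) : Set where
  prime-sum : Prime (x + y) → z ≡ x + y → PrimeOrHalving x y z
  halving   : Halving x y z → PrimeOrHalving x y z

classify : ∀ {x y z} → SubprimeStep x y z → OddPrimeDivision x y z ⊎ PrimeOrHalving x y z
classify (inj₁ (prime[s] , z≡s))                       = inj₂ (prime-sum prime[s] z≡s)
classify (inj₂ (_ , 0 , (p-prime , _) , _))            = contradiction p-prime ¬prime[0]
classify (inj₂ (_ , 1 , (p-prime , _) , _))            = contradiction p-prime ¬prime[1]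
classify (inj₂ (_ , 2 , _ , s≡2z))                     = inj₂ (halving s≡2z)
classify (inj₂ (¬prime[s] , p@(suc (suc (suc _))) , (prime[p] , _ , smallest) , s≡pz)) = inj₁ record
  { p = p ; 3≤p = s≤s (s≤s (s≤s z≤n)) ; p-prime = prime[p]
  ; sum-composite = ¬prime[s] ; sum≡p*z = s≡pz
  ; sum-odd = λ 2∣s → contradiction (smallest 2 prime[2] 2∣s) λ { (s≤s (s≤s ())) } }

module _ {x y z} (d : OddPrimeDivision x y z) where
  open OddPrimeDivision d

  sum≡[3+r]*z : ∃ λ r → x + y ≡ (3 + r) * z
  sum≡[3+r]*z = p ∸ 3 , trans sum≡p*z (cong (_* z) (sym (m+[n∸m]≡n 3≤p)))

  ¬prime[k*z] : ∀ k → 2 ≤ k → ¬ Prime (k * z)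
  ¬prime[k*z] k 2≤k prime[kz] = sum-composite (subst Prime (sym sum≡p) p-prime)
    where
    sum≡p : x + y ≡ p
    sum≡p = trans sum≡p*z (trans (cong (p *_) (prime[k*n]⇒n≡1 k z 2≤k prime[kz])) (*-identityʳ p))

  signature≢1 : 0 < z → (x + y) div z ≢ 1
  signature≢1 (s≤s {n = z'} _) sig≡1 = contradiction (subst (3 ≤_) p≡1 3≤p) λ { (s≤s ()) }
    where
    p≡1 : p ≡ 1
    p≡1 = trans (sym (m*n/n≡m p (suc z'))) (trans (cong (_/ suc z') (sym sum≡p*z)) sig≡1)

record Cycle (m : ℕ) (u : ℕ → ℕ) : Set where
  field
    period   : ∀ i → u (i + m) ≡ u i
    positive : ∀ i → 0 < u i
    rule     : ∀ i → StepAt SubprimeStep u i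

  classify-at : ∀ i → StepAt OddPrimeDivision u i ⊎ StepAt PrimeOrHalving u i
  classify-at i = classify (rule i)

cycle : ∀ {m t} → NontrivialCycle m t → Cycle m t
cycle nc = record { period = period ; positive = positive ; rule = rule }
  where open NontrivialCycle nc

shift : ∀ {m u} → Cycle m u → ∀ J → Cycle m (λ i → u (J + i))
shift {m} {u} C J = record
  { period   = λ i → trans (cong u (sym (+-assoc J i m))) (period (J + i))
  ; positive = λ i → positive (J + i)
  ; rule     = λ i → subst id (sym (StepAt-+ SubprimeStep u J i)) (rule (J + i))
  }
  where open Cycle C

StepAt-periodic : ∀ {m u} R → Cycle m u → ∀ k → StepAt R u (k + m) ≡ StepAt R u k
StepAt-periodic R C k
  rewrite Cycle.period C k | Cycle.period C (suc k) | Cycle.period C (suc (suc k)) = refl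

potential : (ℕ → ℕ) → ℕ → ℕ
potential u k = u k + 2 * u (suc k)

peak : (ℕ → ℕ) → ℕ → ℕ
peak u k = u k ⊔ u (suc k)

potential-periodic : ∀ {m u} → Cycle m u → potential u m ≡ potential u 0
potential-periodic C = cong₂ (λ a b → a + 2 * b) (Cycle.period C 0) (Cycle.period C 1)

peak-periodic : ∀ {m u} → Cycle m u → peak u m ≡ peak u 0
peak-periodic C = cong₂ _⊔_ (Cycle.period C 0) (Cycle.period C 1)

signature-periodic : ∀ {m t} → Cycle m t → ∀ k → signature t (k + m) ≡ signature t k
signature-periodic C k
  rewrite Cycle.period C k | Cycle.period C (suc k) | Cycle.period C (suc (suc k)) = refl

halving-step : ∀ u → StepAt Halving u 0 → potential u 1 ≡ potential u 0 × peak u 1 ≤ peak u 0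
halving-step u s≡2z = potential-eq , ⊔-lub (m≤n⊔m (u 0) (u 1)) z≤peak
  where
  potential-eq : u 1 + 2 * u 2 ≡ u 0 + 2 * u 1
  potential-eq = trans (cong (u 1 +_) (sym s≡2z)) (shuffle (u 0) (u 1))
    where
    shuffle : ∀ a b → b + (a + b) ≡ a + 2 * b
    shuffle = solve-∀
  z≤peak : u 2 ≤ peak u 0
  z≤peak = *-cancelˡ-≤ 2 (begin
    2 * u 2                 ≡⟨ sym s≡2z ⟩
    u 0 + u 1               ≤⟨ +-mono-≤ (m≤m⊔n (u 0) (u 1)) (m≤n⊔m (u 0) (u 1)) ⟩
    peak u 0 + peak u 0     ≡⟨ cong (peak u 0 +_) (sym (+-identityʳ (peak u 0))) ⟩
    2 * peak u 0            ∎)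
    where open ≤-Reasoning

prime-step : ∀ u → u 2 ≡ u 0 + u 1 → potential u 1 ≡ potential u 0 + u 2 × peak u 1 ≡ u 2
prime-step u z≡s = subst (λ z → u 1 + 2 * z ≡ potential u 0 + z × u 1 ⊔ z ≡ z) (sym z≡s)
  (shuffle (u 0) (u 1) , m≤n⇒m⊔n≡n (m≤n+m (u 1) (u 0)))
  where
  shuffle : ∀ a b → b + 2 * (a + b) ≡ (a + 2 * b) + (a + b)
  shuffle = solve-∀

halving-run : ∀ L u → (∀ i → i < L → StepAt Halving u i) →
              potential u L ≡ potential u 0 × peak u L ≤ peak u 0
halving-run zero    u _        = refl , ≤-refl
halving-run (suc L) u halvings =
  let potential₁ , peak₁ = halving-step u (halvings 0 z<s)
      potentialL , peakL = halving-run L (u ∘ suc) (λ i i<L → halvings (suc i) (s<s i<L))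
  in  trans potentialL potential₁ , ≤-trans peakL peak₁

prime-or-halving-run : ∀ L u → (∀ i → i < L → StepAt PrimeOrHalving u i) →
                       (∀ i → i < L → StepAt Halving u i) ⊎ peak u L + potential u 0 ≤ potential u L
prime-or-halving-run zero    u _     = inj₁ λ _ ()
prime-or-halving-run (suc L) u steps
  with steps 0 z<s | prime-or-halving-run L (u ∘ suc) (λ i i<L → steps (suc i) (s<s i<L))
... | halving s≡2z | inj₁ halvings =
  inj₁ λ { zero _ → s≡2z ; (suc i) (s<s i<L) → halvings i i<L }
... | halving s≡2z | inj₂ grows =
  inj₂ (subst (λ Ψ → peak u (suc L) + Ψ ≤ potential u (suc L))
              (proj₁ (halving-step u s≡2z)) grows)
... | prime-sum _ z≡s | inj₁ halvings = inj₂ (begin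
  peak u (suc L) + potential u 0   ≤⟨ +-monoˡ-≤ (potential u 0) (proj₂ tail) ⟩
  peak u 1 + potential u 0         ≡⟨ cong (_+ potential u 0) (proj₂ (prime-step u z≡s)) ⟩
  u 2 + potential u 0              ≡⟨ +-comm (u 2) (potential u 0) ⟩
  potential u 0 + u 2              ≡⟨ sym (proj₁ (prime-step u z≡s)) ⟩
  potential u 1                    ≡⟨ sym (proj₁ tail) ⟩
  potential u (suc L)              ∎)
  where
  open ≤-Reasoning
  tail : potential u (suc L) ≡ potential u 1 × peak u (suc L) ≤ peak u 1
  tail = halving-run L (u ∘ suc) halvings
... | prime-sum _ z≡s | inj₂ grows = inj₂ (begin
  peak u (suc L) + potential u 0           ≤⟨ +-monoʳ-≤ (peak u (suc L)) (m≤m+n (potential u 0) (u 2)) ⟩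
  peak u (suc L) + (potential u 0 + u 2)   ≡⟨ cong (peak u (suc L) +_) (sym (proj₁ (prime-step u z≡s))) ⟩
  peak u (suc L) + potential u 1           ≤⟨ grows ⟩
  potential u (suc L)                      ∎)
  where open ≤-Reasoning

gap : (ℕ → ℕ) → ℕ → ℕ
gap u k = ∣ u (suc k) - u k ∣

halving-gap : ∀ u → StepAt Halving u 0 → gap u 0 ≡ 2 * gap u 1
halving-gap u s≡2z = sym (begin
  2 * ∣ u 2 - u 1 ∣          ≡⟨ *-distribˡ-∣-∣ 2 (u 2) (u 1) ⟩
  ∣ 2 * u 2 - 2 * u 1 ∣      ≡⟨ cong₂ ∣_-_∣ (trans (sym s≡2z) (+-comm (u 0) (u 1))) (double (u 1)) ⟩
  ∣ u 1 + u 0 - u 1 + u 1 ∣  ≡⟨ ∣m+n-m+o∣≡∣n-o∣ (u 1) (u 0) (u 1) ⟩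
  ∣ u 0 - u 1 ∣              ≡⟨ ∣-∣-comm (u 0) (u 1) ⟩
  ∣ u 1 - u 0 ∣              ∎)
  where
  open ≡-Reasoning
  double : ∀ a → 2 * a ≡ a + a
  double = solve-∀

halving-run-gap : ∀ L u → (∀ i → i < L → StepAt Halving u i) → gap u 0 ≡ 2 ^ L * gap u L
halving-run-gap zero    u _        = sym (+-identityʳ (gap u 0))
halving-run-gap (suc L) u halvings = begin
  gap u 0                      ≡⟨ halving-gap u (halvings 0 z<s) ⟩
  2 * gap u 1                  ≡⟨ cong (2 *_) (halving-run-gap L (u ∘ suc) halvings′) ⟩
  2 * (2 ^ L * gap u (suc L))  ≡⟨ sym (*-assoc 2 (2 ^ L) (gap u (suc L))) ⟩
  2 ^ suc L * gap u (suc L)    ∎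
  where
  open ≡-Reasoning
  halvings′ : ∀ i → i < L → StepAt Halving (u ∘ suc) i
  halvings′ i i<L = halvings (suc i) (s<s i<L)

constant-below-period⇒constant : ∀ {a} {A : Set a} m .{{_ : NonZero m}} (u : ℕ → A) →
                                 (∀ i → u (i + m) ≡ u i) → (∀ k → k < m → u k ≡ u 0) →
                                 ∀ i → u i ≡ u 0
constant-below-period⇒constant m u period below i =
  trans (periodic⇒≡% m u period i) (below (i % m) (m%n<n i m))

module _ {m′ u} (C : Cycle (suc m′) u) where
  open Cycle C

  halving-cycle⇒constant : (∀ i → i < suc m′ → StepAt Halving u i) → ∀ i → u i ≡ u 0
  halving-cycle⇒constant halvings = constant-below-period⇒constant (suc m′) u period below
    where
    gap₀≡0 : gap u 0 ≡ 0
    gap₀≡0 = x≡2^[1+k]*x⇒x≡0 (gap u 0) m′ (trans (halving-run-gap (suc m′) u halvings)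
                                                  (cong (2 ^ suc m′ *_) (cong₂ ∣_-_∣ (period 1) (period 0))))
    gap≡0 : ∀ k → k < suc m′ → gap u k ≡ 0
    gap≡0 k k<m with m*n≡0⇒m≡0∨n≡0 (2 ^ k)
      (trans (sym (halving-run-gap k u (λ i i<k → halvings i (<-trans i<k k<m)))) gap₀≡0)
    ... | inj₁ 2^k≡0 = contradiction (m^n≡0⇒m≡0 2 k 2^k≡0) λ ()
    ... | inj₂ gapₖ≡0 = gapₖ≡0
    below : ∀ k → k < suc m′ → u k ≡ u 0
    below zero    _      = refl
    below (suc k) 1+k<m = trans (∣m-n∣≡0⇒m≡n (gap≡0 k k<m)) (below k k<m)
      where
      k<m : k < suc m′
      k<m = <-trans (n<1+n k) 1+k<m

  prime-or-halving-cycle⇒constant : (∀ i → i < suc m′ → StepAt PrimeOrHalving u i) →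
                                    ∀ i → u i ≡ u 0
  prime-or-halving-cycle⇒constant steps with prime-or-halving-run (suc m′) u steps
  ... | inj₁ halvings = halving-cycle⇒constant halvings
  ... | inj₂ grows    =
    contradiction (subst (peak u (suc m′) + potential u 0 ≤_) (potential-periodic C) grows)
                  (<⇒≱ (m<n+m (potential u 0) (≤-trans (positive (suc m′)) (m≤m⊔n _ _))))

even-successors⇒even : ∀ {x y z} → SubprimeStep x y z → 2 ∣ y → 2 ∣ z → 2 ∣ x
even-successors⇒even (inj₁ (_ , z≡s)) 2∣y 2∣z = ∣m+n∣n⇒∣m (subst (2 ∣_) z≡s 2∣z) 2∣y
even-successors⇒even (inj₂ (_ , p , _ , s≡pz)) 2∣y 2∣z =
  ∣m+n∣n⇒∣m (subst (2 ∣_) (sym s≡pz) (∣n⇒∣m*n p 2∣z)) 2∣y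

even-pair-backward : ∀ u → (∀ i → StepAt SubprimeStep u i) →
                     ∀ d → 2 ∣ u d → 2 ∣ u (suc d) → 2 ∣ u 0 × 2 ∣ u 1
even-pair-backward u rule zero    2∣u₀ 2∣u₁ = 2∣u₀ , 2∣u₁
even-pair-backward u rule (suc d) 2∣u₁₊d 2∣u₂₊d =
  even-pair-backward u rule d (even-successors⇒even (rule d) 2∣u₁₊d 2∣u₂₊d) 2∣u₁₊d

module LoneOddPrimeDivision {m′ u} (C : Cycle (2 + m′) u) (odd : StepAt OddPrimeDivision u 0)
         (rest : ∀ i → i < suc m′ → StepAt PrimeOrHalving u (suc i)) where
  open Cycle C
  open OddPrimeDivision odd

  halving-tail⇒u₀≡3u₂ : u 3 ≡ u 1 + u 2 →
                        (∀ i → i < m′ → StepAt Halving (λ i → u (2 + i)) i) → u 0 ≡ 3 * u 2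
  halving-tail⇒u₀≡3u₂ u₃≡u₁+u₂ halvings = +-cancelʳ-≡ (2 * u 1) (u 0) (3 * u 2) (begin
    u 0 + 2 * u 1                ≡⟨ sym (potential-periodic C) ⟩
    potential u (2 + m′)         ≡⟨ proj₁ (halving-run m′ (λ i → u (2 + i)) halvings) ⟩
    u 2 + 2 * u 3                ≡⟨ cong (λ w → u 2 + 2 * w) u₃≡u₁+u₂ ⟩
    u 2 + 2 * (u 1 + u 2)        ≡⟨ shuffle (u 1) (u 2) ⟩
    3 * u 2 + 2 * u 1            ∎)
    where
    open ≡-Reasoning
    shuffle : ∀ a b → b + 2 * (a + b) ≡ 3 * b + 2 * a
    shuffle = solve-∀

  second-even⇒⊥ : 2 ∣ u 1 → ⊥
  second-even⇒⊥ 2∣u₁ with rest 0 z<s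
  ... | halving u₁+u₂≡2u₃ = sum-odd (subst (2 ∣_) (sym sum≡p*z) (∣n⇒∣m*n p 2∣u₂))
    where
    2∣u₂ : 2 ∣ u 2
    2∣u₂ = ∣m+n∣m⇒∣n (subst (2 ∣_) (sym u₁+u₂≡2u₃) (m∣m*n (u 3))) 2∣u₁
  ... | prime-sum u₁+u₂-prime u₃≡u₁+u₂
    with prime-or-halving-run m′ (λ i → u (2 + i)) (λ i i<m′ → rest (suc i) (s<s i<m′))
  ... | inj₂ grows = contradiction (subst (peak u (2 + m′) + potential u 2 ≤_) (potential-periodic C) grows)
                                   (<⇒≱ (subst (λ P → potential u 0 < P + potential u 2) (sym (peak-periodic C))
                                              (+-mono-≤-< (m≤m⊔n (u 0) (u 1)) 2u₁<Ψ₂)))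
    where
    2u₁<Ψ₂ : 2 * u 1 < potential u 2
    2u₁<Ψ₂ = ≤-<-trans (*-monoʳ-≤ 2 (subst (u 1 ≤_) (sym u₃≡u₁+u₂) (m≤m+n (u 1) (u 2))))
                        (m<n+m (2 * u 3) (positive 2))
  ... | inj₁ halvings with sum≡[3+r]*z odd
  ... | zero  , sum≡3u₂ = contradiction u₁≡0 (>⇒≢ (positive 1))
    where
    u₁≡0 : u 1 ≡ 0
    u₁≡0 = cancel-multiple 3 0 (u 2) sum≡3u₂ (halving-tail⇒u₀≡3u₂ u₃≡u₁+u₂ halvings)
  ... | suc r , sum≡[4+r]u₂ =
    ¬prime[k*z] odd (2 + r) (s≤s (s≤s z≤n)) (subst Prime u₁+u₂≡[2+r]u₂ u₁+u₂-prime)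
    where
    u₁≡[1+r]u₂ : u 1 ≡ suc r * u 2
    u₁≡[1+r]u₂ = cancel-multiple 3 (suc r) (u 2) sum≡[4+r]u₂ (halving-tail⇒u₀≡3u₂ u₃≡u₁+u₂ halvings)
    u₁+u₂≡[2+r]u₂ : u 1 + u 2 ≡ (2 + r) * u 2
    u₁+u₂≡[2+r]u₂ = trans (cong (_+ u 2) u₁≡[1+r]u₂) (+-comm (suc r * u 2) (u 2))

  halving-tail⇒u₀≡2u₂ : u (3 + m′) ≡ u (1 + m′) + u (2 + m′) →
                        (∀ i → i < m′ → StepAt Halving (λ i → u (1 + i)) i) → u 0 ≡ 2 * u 2
  halving-tail⇒u₀≡2u₂ y≡w+x halvings =
    trans (sym (period 0)) (+-cancelˡ-≡ (w + x) x (2 * u 2) (begin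
      w + x + x                    ≡⟨ shuffle w x ⟩
      potential u (1 + m′)         ≡⟨ proj₁ (halving-run m′ (λ i → u (1 + i)) halvings) ⟩
      u 1 + 2 * u 2                ≡⟨ cong (_+ 2 * u 2) (trans (sym (period 1)) y≡w+x) ⟩
      w + x + 2 * u 2              ∎))
    where
    open ≡-Reasoning
    w x : ℕ
    w = u (1 + m′)
    x = u (2 + m′)
    shuffle : ∀ a b → a + b + b ≡ a + 2 * b
    shuffle = solve-∀

  first-even⇒⊥ : 2 ∣ u 0 → ⊥
  first-even⇒⊥ 2∣u₀ with rest m′ (n<1+n m′)
  ... | halving w+x≡2y =
    sum-odd (uncurry ∣m∣n⇒∣m+n (even-pair-backward u rule (suc m′) 2∣w 2∣x))
    where
    2∣x : 2 ∣ u (2 + m′)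
    2∣x = subst (2 ∣_) (sym (period 0)) 2∣u₀
    2∣w : 2 ∣ u (1 + m′)
    2∣w = ∣m+n∣n⇒∣m (subst (2 ∣_) (sym w+x≡2y) (m∣m*n (u (3 + m′)))) 2∣x
  ... | prime-sum w+x-prime y≡w+x
    with prime-or-halving-run m′ (λ i → u (1 + i)) (λ i i<m′ → rest i (m<n⇒m<1+n i<m′))
  ... | inj₂ grows = contradiction grows (<⇒≱ (begin-strict
    potential u (1 + m′)               ≡⟨ shuffle w x ⟩
    w + x + x                          ≡⟨ cong (_+ x) (trans (sym y≡w+x) (period 1)) ⟩
    u 1 + x                            ≤⟨ +-monoʳ-≤ (u 1) (m≤n⊔m w x) ⟩
    u 1 + peak u (1 + m′)              ≡⟨ +-comm (u 1) (peak u (1 + m′)) ⟩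
    peak u (1 + m′) + u 1              <⟨ +-monoʳ-< (peak u (1 + m′)) (m<m+n (u 1) 0<2u₂) ⟩
    peak u (1 + m′) + potential u 1    ∎))
    where
    open ≤-Reasoning
    0<2u₂ : 0 < 2 * u 2
    0<2u₂ = ≤-trans (positive 2) (m≤m+n (u 2) _)
    w x : ℕ
    w = u (1 + m′)
    x = u (2 + m′)
    shuffle : ∀ a b → a + 2 * b ≡ a + b + b
    shuffle = solve-∀
  ... | inj₁ halvings with sum≡[3+r]*z odd
  ... | zero , sum≡3u₂ = contradiction 2u₂≤u₂ (<⇒≱ u₂<2u₂)
    where
    u₂<2u₂ : u 2 < 2 * u 2
    u₂<2u₂ = m<m+n (u 2) (≤-trans (positive 2) (m≤m+n (u 2) 0))
    u₀≡2u₂ : u 0 ≡ 2 * u 2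
    u₀≡2u₂ = halving-tail⇒u₀≡2u₂ y≡w+x halvings
    u₁≡u₂ : u 1 ≡ u 2
    u₁≡u₂ = trans (cancel-multiple 2 1 (u 2) sum≡3u₂ u₀≡2u₂) (*-identityˡ (u 2))
    2u₂≤u₂ : 2 * u 2 ≤ u 2
    2u₂≤u₂ = begin
      2 * u 2                      ≡⟨ sym (trans (period 0) u₀≡2u₂) ⟩
      u (2 + m′)                   ≤⟨ m≤n⊔m (u (1 + m′)) (u (2 + m′)) ⟩
      peak u (1 + m′)              ≤⟨ proj₂ (halving-run m′ (λ i → u (1 + i)) halvings) ⟩
      u 1 ⊔ u 2                    ≡⟨ trans (cong (_⊔ u 2) u₁≡u₂) (⊔-idem (u 2)) ⟩
      u 2                          ∎
      where open ≤-Reasoning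
  ... | suc r , sum≡[4+r]u₂ =
    ¬prime[k*z] odd (2 + r) (s≤s (s≤s z≤n)) (subst Prime w+x≡[2+r]u₂ w+x-prime)
    where
    w+x≡[2+r]u₂ : u (1 + m′) + u (2 + m′) ≡ (2 + r) * u 2
    w+x≡[2+r]u₂ = trans (sym y≡w+x) (trans (period 1)
      (cancel-multiple 2 (2 + r) (u 2) sum≡[4+r]u₂ (halving-tail⇒u₀≡2u₂ y≡w+x halvings)))

  impossible : ⊥
  impossible = [ first-even⇒⊥ , second-even⇒⊥ ]′ (odd-sum⇒even-summand sum-odd)

odd-prime-division-recurs : ∀ {m′ u} → Cycle (2 + m′) u → ∀ J → StepAt OddPrimeDivision u J →
                            ∃ λ i → i < suc m′ × StepAt OddPrimeDivision u (J + suc i)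
odd-prime-division-recurs {m′} {u} C J odd
  with bounded-search (λ i → Cycle.classify-at (shift C J) (suc i)) (suc m′)
... | inj₁ (i , i<1+m′ , oddᵢ) = i , i<1+m′ , subst id (StepAt-+ OddPrimeDivision u J (suc i)) oddᵢ
... | inj₂ rest = ⊥-elim (LoneOddPrimeDivision.impossible (shift C J) odd₀ rest)
  where
  odd₀ : StepAt OddPrimeDivision (λ k → u (J + k)) 0
  odd₀ = subst id (sym (StepAt-+ OddPrimeDivision u J 0))
           (subst (StepAt OddPrimeDivision u) (sym (+-identityʳ J)) odd)

TwoNontrivialNodeDivisors : ℕ → (ℕ → ℕ) → Set
TwoNontrivialNodeDivisors m t = ∃ λ e₁ → ∃ λ b₁ → ∃ λ e₂ → ∃ λ b₂ →
  NodeEntry m t (e₁ , b₁) × NodeEntry m t (e₂ , b₂) × (e₁ , b₁) ≢ (e₂ , b₂) ×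
  nodeDivisor t e₁ b₁ ≢ 1 × nodeDivisor t e₂ b₂ ≢ 1

module Nodes {m′ t} (C : Cycle (2 + m′) t) where
  open Cycle C

  m : ℕ
  m = 2 + m′

  -- The odd-prime division producing t (4 + q) is the divisor of the entry (e , b) with
  -- suc e + b ≡ 2 + q, unless q = m - 1 and t (3 + q) is even: then that entry is (m , 0),
  -- which is (0 , 0) one period earlier.
  OddAt : ℕ → Set
  OddAt = StepAt OddPrimeDivision (λ k → t (2 + k))

  data Labels (q : ℕ) : ℕ × ℕ → Set where
    direct  : ∀ {e b} → suc e + b ≡ 2 + q → Labels q (e , b)
    wrapped : suc q ≡ m → Labels q (0 , 0)

  Labels-injective : ∀ {q₁ q₂ eb} → Labels q₁ eb → Labels q₂ eb → q₁ ≡ q₂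
  Labels-injective (direct eq₁)  (direct eq₂)  = suc-injective (suc-injective (trans (sym eq₁) eq₂))
  Labels-injective (direct ())   (wrapped _)
  Labels-injective (wrapped _)   (direct ())
  Labels-injective (wrapped eq₁) (wrapped eq₂) = suc-injective (trans eq₁ (sym eq₂))

  record NontrivialNode (q : ℕ) : Set where
    field
      e b       : ℕ
      entry     : NodeEntry m t (e , b)
      divisor≢1 : nodeDivisor t e b ≢ 1
      labels    : Labels q (e , b)

  odd-division⇒signature≢1 : ∀ {q k} → OddAt q → k ≡ 2 + q → signature t k ≢ 1
  odd-division⇒signature≢1 {q} odd refl = signature≢1 odd (positive (4 + q))

  odd-division⇒node : ∀ {q} → q < m → OddAt q → NontrivialNode q
  odd-division⇒node {q} q<m odd with odd-sum⇒even-summand (OddPrimeDivision.sum-odd odd)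
  ... | inj₁ 2∣t₂₊q = record
    { e = q ; b = 1 ; entry = q<m , 2∣t₂₊q , ≤-refl
    ; divisor≢1 = odd-division⇒signature≢1 odd (cong suc (+-comm q 1))
    ; labels = direct (cong suc (+-comm q 1)) }
  ... | inj₂ 2∣t₃₊q with m≤n⇒m<n∨m≡n q<m
  ...   | inj₁ 1+q<m = record
    { e = suc q ; b = 0 ; entry = 1+q<m , 2∣t₃₊q , z≤n
    ; divisor≢1 = odd-division⇒signature≢1 odd (+-identityʳ (2 + q))
    ; labels = direct (+-identityʳ (2 + q)) }
  ...   | inj₂ refl = record
    { e = 0 ; b = 0 ; entry = z<s , subst (2 ∣_) (period 2) 2∣t₃₊q , z≤n
    ; divisor≢1 = subst (_≢ 1) (signature-periodic C 1) (odd-division⇒signature≢1 odd refl)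
    ; labels = wrapped refl }

  distinct-nodes : ∀ {q₁ q₂} → q₁ ≢ q₂ → NontrivialNode q₁ → NontrivialNode q₂ →
                   TwoNontrivialNodeDivisors m t
  distinct-nodes {q₂ = q₂} q₁≢q₂ n₁ n₂ =
    e n₁ , b n₁ , e n₂ , b n₂ , entry n₁ , entry n₂ ,
    (λ eq → q₁≢q₂ (Labels-injective (labels n₁) (subst (Labels q₂) (sym eq) (labels n₂)))) ,
    divisor≢1 n₁ , divisor≢1 n₂
    where open NontrivialNode

  first-odd-division : (∃ λ i → ∃ λ j → t i ≢ t j) → ∃ λ J → J < m × OddAt J
  first-odd-division (i , j , tᵢ≢tⱼ) with bounded-search (Cycle.classify-at (shift C 2)) m
  ... | inj₁ found = found
  ... | inj₂ steps = contradiction (trans (t≡t₂ i) (sym (t≡t₂ j))) tᵢ≢tⱼ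
    where
    t≡t₂ : ∀ k → t k ≡ t 2
    t≡t₂ k = trans (sym (period k)) (trans (cong t (trans (+-suc k (suc m′)) (cong suc (+-suc k m′))))
                                           (prime-or-halving-cycle⇒constant (shift C 2) steps (k + m′)))

  another-odd-division : ∀ {J} → J < m → OddAt J → ∃ λ q → q < m × q ≢ J × OddAt q
  another-odd-division {J} J<m odd with odd-prime-division-recurs (shift C 2) J odd
  ... | i , i<1+m′ , oddₙ with J + suc i <? m
  ...   | yes n<m = J + suc i , n<m , m+1+n≢m J , oddₙ
  ...   | no  n≮m = q , q<m , q≢J ,
                    subst id (StepAt-periodic OddPrimeDivision (shift C 2) q) (subst OddAt (sym q+m≡n) oddₙ)
    where
    q : ℕ
    q = J + suc i ∸ m
    q+m≡n : q + m ≡ J + suc i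
    q+m≡n = m∸n+n≡m (≮⇒≥ n≮m)
    q<m : q < m
    q<m = +-cancelʳ-< m q m (subst (_< m + m) (sym q+m≡n) (+-mono-< J<m (s<s i<1+m′)))
    q≢J : q ≢ J
    q≢J q≡J = <-irrefl (sym (+-cancelˡ-≡ J m (suc i) (trans (cong (_+ m) (sym q≡J)) q+m≡n)))
                       (s<s i<1+m′)

proposition10 : (m : ℕ) (t : ℕ → ℕ) → NontrivialCycle m t →
    ∃ λ e₁ → ∃ λ b₁ → ∃ λ e₂ → ∃ λ b₂ →
      NodeEntry m t (e₁ , b₁) × NodeEntry m t (e₂ , b₂) × (e₁ , b₁) ≢ (e₂ , b₂) ×
      nodeDivisor t e₁ b₁ ≢ 1 × nodeDivisor t e₂ b₂ ≢ 1
proposition10 zero t nc with NontrivialCycle.m-pos nc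
... | ()
proposition10 1 t nc with NontrivialCycle.notConst nc
... | i , j , tᵢ≢tⱼ = contradiction (trans (t≡t₀ i) (sym (t≡t₀ j))) tᵢ≢tⱼ
  where
  t≡t₀ : ∀ k → t k ≡ t 0
  t≡t₀ = constant-below-period⇒constant 1 t (NontrivialCycle.period nc) λ { zero _ → refl ; (suc _) (s<s ()) }
proposition10 (suc (suc m′)) t nc =
  let J , J<m , oddJ = first-odd-division notConst
      q , q<m , q≢J , oddq = another-odd-division J<m oddJ
  in  distinct-nodes (q≢J ∘ sym) (odd-division⇒node J<m oddJ) (odd-division⇒node q<m oddq)
  where
  open NontrivialCycle nc
  open Nodes (cycle nc)
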